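{- For every tree-oriented map $\vec M$, the image $\varphi_0(\vec M)$ of $\vec M$ under the vertex explosion process is a tree, oriented from the root to the leaves.
   Context: A (rooted planar) map is a 2-cell embedding of a connected planar graph (loops and multiple edges allowed) in the oriented sphere up to orientation-preserving homeomorphism, with a distinguished half-edge, the root; its incident vertex is the root-vertex. A tree is a map with one face. In an oriented map each edge goes from origin (tail) to end (head); the root is considered a head. A positive cycle is a directed simple cycle having the root in its exterior region (the region on its right). An oriented map is tree-oriented if it has no positive cycle and every vertex can be reached from the root-vertex by a directed path. Vertex explosion $\varphi_0$: replace each vertex $v$ by as many vertices as heads incident to $v$, each new vertex carrying one head $h$ of $v$ together with the tails $t$ of $v$ for which $h$ is the first head met when turning counterclockwise around $v$ starting from $t$ (cyclic orders inherited, root kept). -}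

module Defs where

-- Half-edges are Fin n.  σ = counterclockwise rotation around vertices,
-- α = edge involution.  The root is a dangling half-edge ("leg") placed
-- in a corner of the root-vertex: the unique fixed point of α.

open import Data.Nat using (ℕ; zero; suc; _+_; _*_; _≤_; _≤ᵇ_)
open import Data.Fin using (Fin; zero; suc; toℕ; inject₁; fromℕ)
open import Data.Fin.Properties using (_≟_)
open import Data.Bool using (Bool; true; false; if_then_else_; not)
open import Data.Bool.ListAction using (and)
open import Data.List using (List; length; filterᵇ; allFin; upTo) renaming (map to lmap)
open import Data.Product using (Σ; _×_; _,_)
open import Relation.Binary.PropositionalEquality using (_≡_; _≢_)
open import Relation.Nullary using (¬_; yes; no)
open import Function using (_∘_)
open import Function.Definitions using (Injective)

pow : ∀ {A : Set} → (A → A) → ℕ → A → A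
pow f zero x = x
pow f (suc k) x = f (pow f k x)

orbitMinᵇ : ∀ {n} → (Fin n → Fin n) → Fin n → Bool
orbitMinᵇ {n} f x = and (lmap (λ k → toℕ x ≤ᵇ toℕ (pow f k x)) (upTo n))

numCycles : ∀ n → (Fin n → Fin n) → ℕ
numCycles n f = length (filterᵇ (orbitMinᵇ f) (allFin n))

record RawMap (n : ℕ) : Set where
  field
    σ    : Fin n → Fin n
    α    : Fin n → Fin n
    root : Fin n

module _ {n : ℕ} (M : RawMap n) where
  open RawMap M

  SameVertex : Fin n → Fin n → Set
  SameVertex x y = Σ ℕ λ k → pow σ k x ≡ y

  data Conn : Fin n → Set where
    c-root : Conn root
    c-σ    : ∀ {x} → Conn x → Conn (σ x)
    c-α    : ∀ {x} → Conn x → Conn (α x)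

  numVertices numFaces : ℕ
  numVertices = numCycles n σ
  numFaces    = numCycles n (σ ∘ α)

  -- n = 2E + 1 half-edges (E edges plus the root leg); Euler: V - E + F = 2
  record IsMap : Set where
    field
      σ-inj     : Injective _≡_ _≡_ σ
      α-invol   : ∀ x → α (α x) ≡ x
      α-root    : α root ≡ root
      α-fix     : ∀ x → α x ≡ x → x ≡ root
      connected : ∀ x → Conn x
      planar    : 2 * (numVertices + numFaces) ≡ n + 3

  IsTree : Set
  IsTree = IsMap × (numFaces ≡ 1)

  -- half-edges reachable by a directed path from the root-vertex,
  -- w.r.t. an orientation head (head x ≡ true : x is a head)
  data Reach (head : Fin n → Bool) : Fin n → Set where
    r-root : Reach head root
    r-σ    : ∀ {x} → Reach head x → Reach head (σ x)
    r-edge : ∀ {t} → Reach head t → head t ≡ false → Reach head (α t)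

record Map (n : ℕ) : Set where
  field
    raw   : RawMap n
    isMap : IsMap raw
  open RawMap raw public

record OrientedMap (n : ℕ) : Set where
  field
    map      : Map n
  open Map map public
  field
    head     : Fin n → Bool
    head-root : head root ≡ true
    head-α   : ∀ x → x ≢ root → head (α x) ≡ not (head x)

module _ {n : ℕ} (M : OrientedMap n) where
  open OrientedMap M

  -- directed simple cycle: tails ts 0 .. ts k, edge ts i → α (ts i)
  record DirCycle : Set where
    field
      k      : ℕ
      ts     : Fin (suc k) → Fin n
      tails  : ∀ i → head (ts i) ≡ false
      linked : ∀ (i : Fin k) → SameVertex raw (α (ts (inject₁ i))) (ts (suc i))
      closed : SameVertex raw (α (ts (fromℕ k))) (ts zero)
      simple : ∀ i j → SameVertex raw (ts i) (ts j) → i ≡ j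

    inHead : Fin (suc k) → Fin n
    inHead zero    = α (ts (fromℕ k))
    inHead (suc i) = α (ts (inject₁ i))

  -- x lies strictly between h and t turning counterclockwise from h
  Between : Fin n → Fin n → Fin n → Set
  Between h t x = Σ ℕ λ j → (pow σ (suc j) h ≡ x) × (∀ m → m ≤ j → pow σ (suc m) h ≢ t)

  -- half-edges lying in the region on the right of the directed cycle
  data RightOf (C : DirCycle) : Fin n → Set where
    rt-seed : ∀ i {x} → Between (DirCycle.inHead C i) (DirCycle.ts C i) x → RightOf C x
    rt-α    : ∀ {x} → RightOf C x → RightOf C (α x)
    rt-σ    : ∀ {x} → RightOf C x → (∀ i → ¬ SameVertex raw x (DirCycle.ts C i)) → RightOf C (σ x)

  -- positive cycle: root in the exterior region (the region on its right)
  record PositiveCycle : Set where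
    field
      cycle     : DirCycle
      rootRight : RightOf cycle root

  TreeOriented : Set
  TreeOriented = (¬ PositiveCycle) × (∀ x → Reach raw head x)

  -- vertex explosion φ₀.  For a head h: p = last head met turning ccw from h
  -- before returning to h (p = h if none); then σ' h = σ p.  For a tail, σ' t = σ t.
  lastHead : Fin n → ℕ → Fin n → Fin n → Fin n
  lastHead h zero cur best = best
  lastHead h (suc f) cur best with cur ≟ h
  ... | yes _ = best
  ... | no _  = lastHead h f (σ cur) (if head cur then cur else best)

  σ₀ : Fin n → Fin n
  σ₀ x = if head x then σ (lastHead x n (σ x) x) else σ x

  φ₀ : RawMap n
  φ₀ = record { σ = σ₀ ; α = α ; root = root }

-- After the explosion every vertex carries exactly one head, namely the first head met
-- counterclockwise from any of its half-edges, so the cycles of σ₀ correspond to heads.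
-- Call the head of the vertex containing the tail α h the parent of a head h ≠ root.
-- A cycle of parents is a closed directed walk through tails; shortcutting it yields a
-- simple directed cycle with a prescribed head in the sector where the walk leaves a
-- vertex. Following directed paths from the root, no half-edge reachable from the root
-- ever lies to the right of such a cycle (there is no positive cycle) or at a vertex of
-- one of the walk's tails, which the tail α h of the parent cycle itself contradicts.
-- Hence every parent chain ends at the root: all of φ₀ is reachable, and σ₀ ∘ α goes
-- around the resulting tree as a single contour. Counting then gives V = #heads = E + 1
-- and F = 1, which is Euler's relation.
module Submission where

open import Defs
open import Data.Bool using (Bool; true; false; if_then_else_; not; _∧_; T)
open import Data.Bool.Properties as Bool using (∧-zeroʳ; ∧-identityʳ; T-≡; ¬-not)
open import Data.Empty using (⊥; ⊥-elim)
open import Data.Fin using (Fin; zero; suc; toℕ; inject₁; fromℕ; punchIn)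
open import Data.Fin.Properties using (_≟_; pigeonhole; toℕ-injective; toℕ<n; punchInᵢ≢i)
open import Data.List using (List; []; _∷_; _++_; length; lookup; filterᵇ; allFin; tabulate; applyUpTo)
open import Data.List.Extrema.Nat using (argmin; argmin-all; f[argmin]≤f[xs])
open import Data.List.Membership.Propositional using (find)
open import Data.List.Membership.Propositional.Properties using (∈-∃++; ∈-lookup)
open import Data.List.Relation.Unary.All as All using (All; []; _∷_)
open import Data.List.Relation.Unary.All.Properties
  using (all⁺; all⁻; ¬Any⇒All¬; ++⁺; ++⁻ˡ; ++⁻ʳ; applyUpTo⁺₁; applyUpTo⁻)
open import Data.List.Relation.Unary.AllPairs using (AllPairs; []; _∷_)
open import Data.List.Relation.Unary.Any using (Any; any?)
open import Data.Nat using (ℕ; zero; suc; _+_; _*_; _∸_; _≤_; _<_; z≤n; s≤s; s≤s⁻¹; z<s)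
open import Data.Nat.DivMod using (_%_; _/_; m≡m%n+[m/n]*n; m%n<n)
open import Data.Nat.Induction using (<-rec; <-wellFounded)
open import Data.Nat.Properties
  using ( +-identityʳ; +-assoc; +-comm; +-suc; *-comm; *-suc; *-distribˡ-+; +-monoˡ-≤
        ; m≤m+n; m≤n+m; m≤n⇒m≤1+n; m≤n⇒m<n∨m≡n; <-cmp; n≤1+n; n<1+n
        ; ≤-refl; ≤-reflexive; ≤-trans; ≤-antisym; <-≤-trans; ≤-<-trans; <⇒≤; ≤∧≢⇒<; ≮⇒≥
        ; m∸n+n≡m; m+[n∸m]≡n; m∸n≤m; m+n≤o⇒m≤o; ≤ᵇ⇒≤; ≤⇒≤ᵇ; anyUpTo?; +-0-commutativeMonoid
        ; module ≤-Reasoning )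
open import Data.Nat.Solver using (module +-*-Solver)
open import Data.Product using (Σ; _×_; _,_; proj₁; proj₂)
open import Data.Sum using (_⊎_; inj₁; inj₂; [_,_]′)
open import Data.Unit using (⊤; tt)
open import Function using (_∘_; id; case_of_)
open import Function.Bundles using (Equivalence)
open import Function.Definitions using (Injective)
open import Induction.WellFounded using (Acc; acc)
open import Relation.Binary.Definitions using (tri<; tri≈; tri>)
open import Relation.Binary.PropositionalEquality
open import Relation.Nullary using (¬_; Dec; yes; no; does; contradiction)
open import Relation.Nullary.Decidable using (dec-true; dec-false)
open import Relation.Unary using (Decidable)
open import Algebra.Properties.CommutativeMonoid.Sum +-0-commutativeMonoid
  using (sum; sum-syntax; sum-cong-≗; sum-remove; sum-replicate-zero; ∑-comm; ∑-distrib-+)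

module _ {A : Set} (f : A → A) where

  pow-sucʳ : ∀ k x → pow f k (f x) ≡ f (pow f k x)
  pow-sucʳ zero    x = refl
  pow-sucʳ (suc k) x = cong f (pow-sucʳ k x)

  pow-+ : ∀ a b x → pow f (a + b) x ≡ pow f a (pow f b x)
  pow-+ zero    b x = refl
  pow-+ (suc a) b x = cong f (pow-+ a b x)

  pow-periodic : ∀ {p x} → pow f (suc p) x ≡ x → ∀ m → pow f (m * suc p) x ≡ x
  pow-periodic         fix zero    = refl
  pow-periodic {p} {x} fix (suc m) = begin
    pow f (suc p + m * suc p) x         ≡⟨ pow-+ (suc p) (m * suc p) x ⟩
    pow f (suc p) (pow f (m * suc p) x) ≡⟨ cong (pow f (suc p)) (pow-periodic fix m) ⟩
    pow f (suc p) x                     ≡⟨ fix ⟩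
    x                                   ∎
    where open ≡-Reasoning

  pow-mod : ∀ {p x} → pow f (suc p) x ≡ x → ∀ k → pow f k x ≡ pow f (k % suc p) x
  pow-mod {p} {x} fix k = begin
    pow f k x                                       ≡⟨ cong (λ m → pow f m x) (m≡m%n+[m/n]*n k (suc p)) ⟩
    pow f (k % suc p + k / suc p * suc p) x         ≡⟨ pow-+ (k % suc p) _ x ⟩
    pow f (k % suc p) (pow f (k / suc p * suc p) x) ≡⟨ cong (pow f (k % suc p)) (pow-periodic fix (k / suc p)) ⟩
    pow f (k % suc p) x                             ∎
    where open ≡-Reasoning

  pow-∸-suc : ∀ {m t} → m ≤ t → ∀ x → pow f (t ∸ m) (pow f (suc m) x) ≡ pow f (suc t) x
  pow-∸-suc {m} {t} m≤t x = trans (sym (pow-+ (t ∸ m) (suc m) x))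
    (cong (λ i → pow f i x) (trans (+-suc (t ∸ m) m) (cong suc (m∸n+n≡m m≤t))))

  pow-injective : Injective _≡_ _≡_ f → ∀ k {x y} → pow f k x ≡ pow f k y → x ≡ y
  pow-injective f-inj zero    eq = eq
  pow-injective f-inj (suc k) eq = pow-injective f-inj k (f-inj eq)

SameOrbit : ∀ {A : Set} → (A → A) → A → A → Set
SameOrbit f x y = Σ ℕ λ k → pow f k x ≡ y

minimal-witness : ∀ {P : ℕ → Set} → Decidable P → ∀ K → P K → Σ ℕ λ k → P k × (∀ {i} → i < k → ¬ P i)
minimal-witness {P} P? = <-rec (λ K → P K → Least) search
  where
  Least : Set
  Least = Σ ℕ λ k → P k × (∀ {i} → i < k → ¬ P i)
  search : ∀ K → (∀ {k} → k < K → P k → Least) → P K → Least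
  search K smaller pK with anyUpTo? P? K
  ... | yes (k , k<K , pk) = smaller k<K pk
  ... | no none            = K , pK , λ i<K pi → none (_ , i<K , pi)

pow-eventually-periodic : ∀ {n} (f : Fin n → Fin n) x →
  Σ ℕ λ i → Σ ℕ λ d → i + suc d ≤ n × pow f (suc d) (pow f i x) ≡ pow f i x
pow-eventually-periodic {n} f x with pigeonhole (n<1+n n) (λ i → pow f (toℕ i) x)
... | i , j , i<j , eq = toℕ i , d , subst (_≤ n) (sym j≡i+d+1) (s≤s⁻¹ (toℕ<n j)) , (begin
  pow f (suc d) (pow f (toℕ i) x) ≡⟨ pow-+ f (suc d) (toℕ i) x ⟨
  pow f (suc d + toℕ i) x         ≡⟨ cong (λ m → pow f m x) (trans (+-comm (suc d) (toℕ i)) j≡i+d+1) ⟩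
  pow f (toℕ j) x                 ≡⟨ eq ⟨
  pow f (toℕ i) x                 ∎)
  where
  open ≡-Reasoning
  d = toℕ j ∸ suc (toℕ i)
  j≡i+d+1 : toℕ i + suc d ≡ toℕ j
  j≡i+d+1 = trans (+-suc (toℕ i) d) (m+[n∸m]≡n i<j)

module Orbits {n : ℕ} {f : Fin n → Fin n} (f-injective : Injective _≡_ _≡_ f) where

  period : ∀ x → Σ ℕ λ p → suc p ≤ n × pow f (suc p) x ≡ x
  period x with pow-eventually-periodic f x
  ... | i , d , i+d+1≤n , periodic = d , ≤-trans (m≤n+m (suc d) i) i+d+1≤n ,
    pow-injective f f-injective i (begin
    pow f i (pow f (suc d) x) ≡⟨ pow-+ f i (suc d) x ⟨
    pow f (i + suc d) x       ≡⟨ cong (λ m → pow f m x) (+-comm i (suc d)) ⟩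
    pow f (suc d + i) x       ≡⟨ pow-+ f (suc d) i x ⟩
    pow f (suc d) (pow f i x) ≡⟨ periodic ⟩
    pow f i x                 ∎)
    where open ≡-Reasoning

  orbit-refl : ∀ {x} → SameOrbit f x x
  orbit-refl = 0 , refl

  orbit-trans : ∀ {x y z} → SameOrbit f x y → SameOrbit f y z → SameOrbit f x z
  orbit-trans {x} (k , fᵏx≡y) (l , fˡy≡z) = l + k , trans (pow-+ f l k x) (trans (cong (pow f l) fᵏx≡y) fˡy≡z)

  orbit-sym : ∀ {x y} → SameOrbit f x y → SameOrbit f y x
  orbit-sym {x} (k , refl) with period x
  ... | p , _ , fix = p * k , (begin
    pow f (p * k) (pow f k x) ≡⟨ pow-+ f (p * k) k x ⟨
    pow f (p * k + k) x       ≡⟨ cong (λ m → pow f m x) (trans (+-comm (p * k) k) (*-comm (suc p) k)) ⟩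
    pow f (k * suc p) x       ≡⟨ pow-periodic f fix k ⟩
    x                         ∎)
    where open ≡-Reasoning

  orbit-bounded : ∀ {x y} → SameOrbit f x y → Σ ℕ λ k → k < n × pow f k x ≡ y
  orbit-bounded {x} (k , fᵏx≡y) with period x
  ... | p , p<n , fix = k % suc p , ≤-trans (m%n<n k (suc p)) p<n , trans (sym (pow-mod f fix k)) fᵏx≡y

  orbit? : ∀ x y → Dec (SameOrbit f x y)
  orbit? x y with anyUpTo? (λ k → pow f k x ≟ y) n
  ... | yes (k , _ , fᵏx≡y) = yes (k , fᵏx≡y)
  ... | no none             = no λ x~y → none (orbit-bounded x~y)

  orbitRep : Fin n → Fin n
  orbitRep x = argmin toℕ x (applyUpTo (λ k → pow f k x) n)

  orbitRep-orbit : ∀ x → SameOrbit f x (orbitRep x)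
  orbitRep-orbit x = argmin-all toℕ {P = SameOrbit f x} orbit-refl (applyUpTo⁺₁ _ n λ {k} _ → k , refl)

  orbitRep-minimal : ∀ x {y} → SameOrbit f x y → toℕ (orbitRep x) ≤ toℕ y
  orbitRep-minimal x x~y with orbit-bounded x~y
  ... | k , k<n , refl = applyUpTo⁻ _ n (f[argmin]≤f[xs] {f = toℕ} x (applyUpTo (λ k → pow f k x) n)) k<n

  orbitMin-intro : ∀ x → (∀ {y} → SameOrbit f x y → toℕ x ≤ toℕ y) → T (orbitMinᵇ f x)
  orbitMin-intro x min = all⁻ _ (applyUpTo⁺₁ _ n λ {k} _ → ≤⇒≤ᵇ (min (k , refl)))

  orbitMin-elim : ∀ {x y} → T (orbitMinᵇ f x) → SameOrbit f x y → toℕ x ≤ toℕ y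
  orbitMin-elim {x} om x~y with orbit-bounded x~y
  ... | k , k<n , refl = ≤ᵇ⇒≤ _ _ (applyUpTo⁻ _ n (all⁺ _ _ om) k<n)

  orbitMin-orbitRep : ∀ x → T (orbitMinᵇ f (orbitRep x))
  orbitMin-orbitRep x = orbitMin-intro (orbitRep x) λ r~y → orbitRep-minimal x (orbit-trans (orbitRep-orbit x) r~y)

  orbitRep-orbitMin : ∀ {x y} → T (orbitMinᵇ f x) → SameOrbit f x y → orbitRep y ≡ x
  orbitRep-orbitMin {x} {y} om x~y = toℕ-injective (≤-antisym
    (orbitRep-minimal y (orbit-sym x~y))
    (orbitMin-elim om (orbit-trans x~y (orbitRep-orbit y))))

indicator : Bool → ℕ
indicator b = if b then 1 else 0

count : ∀ {n} → (Fin n → Bool) → ℕ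
count {n} p = length (filterᵇ p (allFin n))

length-filterᵇ-tabulate : ∀ {A : Set} (p : A → Bool) {m} (g : Fin m → A) →
                          length (filterᵇ p (tabulate g)) ≡ sum (indicator ∘ p ∘ g)
length-filterᵇ-tabulate p {zero}  g = refl
length-filterᵇ-tabulate p {suc m} g with p (g zero)
... | true  = cong suc (length-filterᵇ-tabulate p (g ∘ suc))
... | false = length-filterᵇ-tabulate p (g ∘ suc)

count≡sum : ∀ {n} (p : Fin n → Bool) → count p ≡ sum (indicator ∘ p)
count≡sum p = length-filterᵇ-tabulate p id

sum-single : ∀ {m} (t : Fin m → ℕ) (c : Fin m) → (∀ i → i ≢ c → t i ≡ 0) → sum t ≡ t c
sum-single {suc m} t c vanish = begin
  sum t                              ≡⟨ sum-remove {i = c} t ⟩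
  t c + sum (t ∘ punchIn c) ≡⟨ cong (t c +_) (sum-cong-≗ {m} (λ j → vanish _ (punchInᵢ≢i c j))) ⟩
  t c + sum {m} (λ _ → 0)            ≡⟨ cong (t c +_) (sum-replicate-zero m) ⟩
  t c + 0                            ≡⟨ +-identityʳ (t c) ⟩
  t c                                ∎
  where open ≡-Reasoning

count-bijection : ∀ {n} (p q : Fin n → Bool) (φ ψ : Fin n → Fin n) →
  (∀ {x} → p x ≡ true → q (φ x) ≡ true) → (∀ {y} → q y ≡ true → p (ψ y) ≡ true) →
  (∀ {x} → p x ≡ true → ψ (φ x) ≡ x) → (∀ {y} → q y ≡ true → φ (ψ y) ≡ y) →
  count p ≡ count q
count-bijection {n} p q φ ψ pq qp ψφ φψ = begin
  count p                                 ≡⟨ count≡sum p ⟩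
  ∑[ x < n ] indicator (p x)              ≡⟨ sum-cong-≗ {n} row ⟨
  ∑[ x < n ] ∑[ y < n ] incidence x y     ≡⟨ ∑-comm incidence ⟩
  ∑[ y < n ] ∑[ x < n ] incidence x y     ≡⟨ sum-cong-≗ {n} column ⟩
  ∑[ y < n ] indicator (q y)              ≡⟨ count≡sum q ⟨
  count q                                 ∎
  where
  open ≡-Reasoning
  incidence : Fin n → Fin n → ℕ
  incidence x y = indicator (p x ∧ does (y ≟ φ x))

  row : ∀ x → sum (incidence x) ≡ indicator (p x)
  row x = trans (sum-single (incidence x) (φ x) off) on
    where
    off : ∀ y → y ≢ φ x → incidence x y ≡ 0
    off y y≢φx rewrite dec-false (y ≟ φ x) y≢φx | ∧-zeroʳ (p x) = refl
    on : incidence x (φ x) ≡ indicator (p x)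
    on rewrite dec-true (φ x ≟ φ x) refl | ∧-identityʳ (p x) = refl

  column : ∀ y → sum (λ x → incidence x y) ≡ indicator (q y)
  column y with q y in qy
  ... | true = trans (sum-single _ (ψ y) off) on
    where
    off : ∀ x → x ≢ ψ y → incidence x y ≡ 0
    off x x≢ψy with p x in px | y ≟ φ x
    ... | false | _        = refl
    ... | true  | no _     = refl
    ... | true  | yes y≡φx = contradiction (trans (sym (ψφ px)) (cong ψ (sym y≡φx))) x≢ψy
    on : incidence (ψ y) y ≡ 1
    on rewrite qp qy | dec-true (y ≟ φ (ψ y)) (sym (φψ qy)) = refl
  ... | false = trans (sum-cong-≗ {n} vanish) (sum-replicate-zero n)
    where
    vanish : ∀ x → incidence x y ≡ 0
    vanish x with p x in px | y ≟ φ x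
    ... | false | _        = refl
    ... | true  | no _     = refl
    ... | true  | yes y≡φx = contradiction (trans (sym (pq px)) (trans (cong q (sym y≡φx)) qy)) λ ()

count-single : ∀ {n} (c : Fin n) → count (λ x → does (x ≟ c)) ≡ 1
count-single c = trans (count≡sum (λ x → does (x ≟ c))) (trans (sum-single _ c off) on)
  where
  off : ∀ x → x ≢ c → indicator (does (x ≟ c)) ≡ 0
  off x x≢c rewrite dec-false (x ≟ c) x≢c = refl
  on : indicator (does (c ≟ c)) ≡ 1
  on rewrite dec-true (c ≟ c) refl = refl

sum-ones : ∀ m → sum {m} (λ _ → 1) ≡ m
sum-ones zero    = refl
sum-ones (suc m) = cong suc (sum-ones m)

count-complement : ∀ {n} (p : Fin n → Bool) → count p + count (not ∘ p) ≡ n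
count-complement {n} p = begin
  count p + count (not ∘ p)                           ≡⟨ cong₂ _+_ (count≡sum p) (count≡sum (not ∘ p)) ⟩
  sum (indicator ∘ p) + sum (indicator ∘ not ∘ p)     ≡⟨ ∑-distrib-+ (indicator ∘ p) (indicator ∘ not ∘ p) ⟨
  ∑[ x < n ] (indicator (p x) + indicator (not (p x))) ≡⟨ sum-cong-≗ {n} (λ x → one (p x)) ⟩
  sum {n} (λ _ → 1)                                   ≡⟨ sum-ones n ⟩
  n                                                   ∎
  where
  open ≡-Reasoning
  one : ∀ b → indicator b + indicator (not b) ≡ 1
  one true  = refl
  one false = refl

count-remove : ∀ {n} (p : Fin n → Bool) {c} → p c ≡ true →
               count p ≡ count (λ x → p x ∧ not (does (x ≟ c))) + 1
count-remove {n} p {c} pc = begin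
  count p                                                      ≡⟨ count≡sum p ⟩
  sum (indicator ∘ p)                                          ≡⟨ sum-cong-≗ {n} split ⟩
  ∑[ x < n ] (indicator (p′ x) + indicator (does (x ≟ c)))     ≡⟨ ∑-distrib-+ (indicator ∘ p′) _ ⟩
  sum (indicator ∘ p′) + sum (λ x → indicator (does (x ≟ c)))  ≡⟨ cong₂ _+_ (count≡sum p′) (count≡sum is-c) ⟨
  count p′ + count is-c                                        ≡⟨ cong (count p′ +_) (count-single c) ⟩
  count p′ + 1                                                 ∎
  where
  open ≡-Reasoning
  is-c p′ : Fin n → Bool
  is-c x = does (x ≟ c)
  p′ x = p x ∧ not (is-c x)
  split : ∀ x → indicator (p x) ≡ indicator (p′ x) + indicator (does (x ≟ c))
  split x with x ≟ c
  ... | yes refl rewrite pc = refl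
  ... | no _ with p x
  ...   | true  = refl
  ...   | false = refl

module _ {n} {f : Fin n → Fin n} (f-injective : Injective _≡_ _≡_ f) where
  open Orbits f-injective

  numCycles-transversal : (p : Fin n → Bool) (sel : Fin n → Fin n) →
    (∀ x → p (sel x) ≡ true) → (∀ x → SameOrbit f x (sel x)) →
    (∀ {x y} → p x ≡ true → p y ≡ true → SameOrbit f x y → x ≡ y) →
    numCycles n f ≡ count p
  numCycles-transversal p sel p-sel sel-orbit p-unique = count-bijection (orbitMinᵇ f) p sel orbitRep
    (λ _ → p-sel _)
    (λ _ → Equivalence.to T-≡ (orbitMin-orbitRep _))
    (λ om → orbitRep-orbitMin (Equivalence.from T-≡ om) (sel-orbit _))
    (λ {y} py → p-unique (p-sel _) py (orbit-sym (orbit-trans (orbitRep-orbit y) (sel-orbit _))))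

  numCycles-transitive : ∀ c → (∀ x → SameOrbit f x c) → numCycles n f ≡ 1
  numCycles-transitive c to-c = trans
    (numCycles-transversal (λ x → does (x ≟ c)) (λ _ → c) (λ _ → dec-true (c ≟ c) refl) to-c
      λ {x} {y} px py _ → trans (is-c px) (sym (is-c py)))
    (count-single c)
    where
    is-c : ∀ {x} → does (x ≟ c) ≡ true → x ≡ c
    is-c {x} px with x ≟ c
    ... | yes x≡c = x≡c

module _ {A : Set} where

  lastFrom : A → List A → A
  lastFrom x []       = x
  lastFrom x (z ∷ zs) = lastFrom z zs

  lastFrom-++ : ∀ x xs z ys → lastFrom x (xs ++ z ∷ ys) ≡ lastFrom z ys
  lastFrom-++ x []       z ys = refl
  lastFrom-++ x (w ∷ xs) z ys = lastFrom-++ w xs z ys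

  lastFrom-All : ∀ {P : A → Set} x xs → All P (x ∷ xs) → P (lastFrom x xs)
  lastFrom-All x []       (px ∷ _)   = px
  lastFrom-All x (z ∷ zs) (_ ∷ pzs) = lastFrom-All z zs pzs

  lookup-lastFrom : ∀ x xs → lookup (x ∷ xs) (fromℕ (length xs)) ≡ lastFrom x xs
  lookup-lastFrom x []       = refl
  lookup-lastFrom x (z ∷ zs) = lookup-lastFrom z zs

  Chain : (A → A → Set) → A → List A → Set
  Chain R x []       = ⊤
  Chain R x (z ∷ zs) = R x z × Chain R z zs

  chain-split : ∀ {R} x xs z ys → Chain R x (xs ++ z ∷ ys) → Chain R x xs × R (lastFrom x xs) z × Chain R z ys
  chain-split x []       z ys (r , c) = tt , r , c
  chain-split x (w ∷ xs) z ys (r , c) with chain-split w xs z ys c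
  ... | c₁ , r₂ , c₂ = (r , c₁) , r₂ , c₂

  chain-join : ∀ {R} x xs z ys → Chain R x xs → R (lastFrom x xs) z → Chain R z ys → Chain R x (xs ++ z ∷ ys)
  chain-join x []       z ys _        r c = r , c
  chain-join x (w ∷ xs) z ys (r₁ , c₁) r c = r₁ , chain-join w xs z ys c₁ r c

  chain-lookup : ∀ {R} x zs → Chain R x zs →
                 ∀ (i : Fin (length zs)) → R (lookup (x ∷ zs) (inject₁ i)) (lookup zs i)
  chain-lookup x (z ∷ zs) (r , _) zero    = r
  chain-lookup x (z ∷ zs) (_ , c) (suc i) = chain-lookup z zs c i

  allPairs-lookup-injective : ∀ {R : A → A → Set} → (∀ {a b} → R a b → R b a) →
    ∀ {xs} → AllPairs (λ a b → ¬ R a b) xs → ∀ i j → R (lookup xs i) (lookup xs j) → i ≡ j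
  allPairs-lookup-injective R-sym {x ∷ xs} _              zero    zero    _ = refl
  allPairs-lookup-injective R-sym {x ∷ xs} (¬Rx ∷ _)      zero    (suc j) r =
    contradiction r (All.lookup ¬Rx (∈-lookup j))
  allPairs-lookup-injective R-sym {x ∷ xs} (¬Rx ∷ _)      (suc i) zero    r =
    contradiction (R-sym r) (All.lookup ¬Rx (∈-lookup i))
  allPairs-lookup-injective R-sym {x ∷ xs} (_ ∷ distinct) (suc i) (suc j) r =
    cong suc (allPairs-lookup-injective R-sym distinct i j r)

  split-at-any : ∀ {P : A → Set} {xs} → Any P xs →
                 Σ (List A) λ as → Σ A λ z → Σ (List A) λ bs → xs ≡ as ++ z ∷ bs × P z
  split-at-any any with find any
  ... | z , z∈xs , pz with ∈-∃++ z∈xs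
  ...   | as , bs , eq = as , z , bs , eq , pz

  Repetition : (A → A → Set) → List A → Set
  Repetition R xs = Σ (List A) λ as → Σ A λ u → Σ (List A) λ bs → Σ A λ w → Σ (List A) λ cs →
                    xs ≡ as ++ u ∷ bs ++ w ∷ cs × R u w

  repetition-or-allPairs : ∀ {R : A → A → Set} → (∀ a b → Dec (R a b)) →
                           ∀ xs → Repetition R xs ⊎ AllPairs (λ a b → ¬ R a b) xs
  repetition-or-allPairs R? []       = inj₂ []
  repetition-or-allPairs R? (x ∷ xs) with any? (R? x) xs
  ... | yes any with split-at-any any
  ...   | bs , w , cs , refl , r = inj₁ ([] , x , bs , w , cs , refl , r)
  repetition-or-allPairs R? (x ∷ xs) | no none with repetition-or-allPairs R? xs
  ... | inj₁ (as , u , bs , w , cs , refl , r) = inj₁ (x ∷ as , u , bs , w , cs , refl , r)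
  ... | inj₂ distinct                          = inj₂ (¬Any⇒All¬ xs none ∷ distinct)

  length-<-++ʳ : ∀ xs (z : A) ys → length ys < length (xs ++ z ∷ ys)
  length-<-++ʳ []       z ys = n<1+n _
  length-<-++ʳ (x ∷ xs) z ys = m≤n⇒m≤1+n (length-<-++ʳ xs z ys)

  length-<-++ˡ : ∀ xs (z : A) ys → length xs < length (xs ++ z ∷ ys)
  length-<-++ˡ []       z ys = s≤s z≤n
  length-<-++ˡ (x ∷ xs) z ys = s≤s (length-<-++ˡ xs z ys)

  length-<-cut : ∀ as (u : A) bs w cs → length (as ++ w ∷ cs) < length (as ++ u ∷ bs ++ w ∷ cs)
  length-<-cut []       u bs w cs = s≤s (length-<-++ʳ bs w cs)
  length-<-cut (a ∷ as) u bs w cs = s≤s (length-<-cut as u bs w cs)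

module Explosion {n : ℕ} (M : OrientedMap n) where
  open OrientedMap M
  open IsMap isMap

  open Orbits σ-inj public using ()
    renaming (orbit-refl to vertex-refl; orbit-sym to vertex-sym; orbit-trans to vertex-trans; orbit? to vertex?)

  α-injective : Injective _≡_ _≡_ α
  α-injective {x} {y} eq = trans (sym (α-invol x)) (trans (cong α eq) (α-invol y))

  head≢tail : ∀ {x y} → head x ≡ true → head y ≡ false → x ≢ y
  head≢tail hx hy refl = contradiction (trans (sym hx) hy) λ ()

  tail⇒≢root : ∀ {x} → head x ≡ false → x ≢ root
  tail⇒≢root hx = head≢tail head-root hx ∘ sym

  α-tail : ∀ {x} → head x ≡ false → head (α x) ≡ true
  α-tail {x} hx = trans (head-α x (tail⇒≢root hx)) (cong not hx)

  α-head : ∀ {x} → head x ≡ true → x ≢ root → head (α x) ≡ false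
  α-head {x} hx x≢root = trans (head-α x x≢root) (cong not hx)

  α-≢root : ∀ {x} → x ≢ root → α x ≢ root
  α-≢root x≢root αx≡root = x≢root (α-injective (trans αx≡root (sym α-root)))

  TailPath : ℕ → Fin n → Fin n → Set
  TailPath e x y = pow σ e x ≡ y × (∀ i → i < e → head (pow σ i x) ≡ false)

  tailPath-snoc : ∀ {e x y} → TailPath e x y → head y ≡ false → TailPath (suc e) x (σ y)
  tailPath-snoc {e} (refl , tails) hy = refl , λ i i<1+e → case m≤n⇒m<n∨m≡n (s≤s⁻¹ i<1+e) of λ where
    (inj₁ i<e)  → tails i i<e
    (inj₂ refl) → hy

  tailPath-uncons : ∀ {e x y} → TailPath (suc e) x y → TailPath e (σ x) y
  tailPath-uncons {e} {x} (path , tails) =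
    trans (pow-sucʳ σ e x) path , λ i i<e → trans (cong head (pow-sucʳ σ i x)) (tails (suc i) (s≤s i<e))

  tailPath-from-tail : ∀ {e x y} → head x ≡ false → TailPath e x y → head y ≡ true →
                       Σ ℕ λ e′ → TailPath e′ (σ x) y
  tailPath-from-tail {zero}  hx (refl , _) hy = contradiction refl (head≢tail hy hx)
  tailPath-from-tail {suc e} hx path       hy = e , tailPath-uncons path

  tailPath-length-unique : ∀ {e e′ x y y′} → TailPath e x y → head y ≡ true →
                           TailPath e′ x y′ → head y′ ≡ true → e ≡ e′
  tailPath-length-unique {e} {e′} (refl , tails) hy (refl , tails′) hy′ with <-cmp e e′
  ... | tri< e<e′ _ _ = contradiction refl (head≢tail hy (tails′ e e<e′))
  ... | tri≈ _ e≡e′ _ = e≡e′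
  ... | tri> _ _ e′<e = contradiction refl (head≢tail hy′ (tails e′ e′<e))

  tailPath-unique : ∀ {e e′ x y y′} → TailPath e x y → head y ≡ true →
                    TailPath e′ x y′ → head y′ ≡ true → y ≡ y′
  tailPath-unique p hy p′ hy′ with tailPath-length-unique p hy p′ hy′
  ... | refl = trans (sym (proj₁ p)) (proj₁ p′)

  precedingHead : Fin n → Fin n
  precedingHead h = lastHead M h n (σ h) h

  PrecedingHead : Fin n → Fin n → Set
  PrecedingHead h q = head q ≡ true × Σ ℕ λ d → TailPath d (σ q) h

  -- Loop invariant of lastHead: best is the last head seen, and only tails lie between it and cur.
  lastHead-preceding : ∀ {h} fuel cur best → head best ≡ true → ∀ {e} → TailPath e (σ best) cur →
                       ∀ r → r ≤ fuel → pow σ r cur ≡ h → PrecedingHead h (lastHead M h fuel cur best)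
  lastHead-preceding zero cur best hb path zero z≤n refl = hb , _ , path
  lastHead-preceding {h} (suc fuel) cur best hb path r r≤1+fuel σʳcur≡h with cur ≟ h
  ... | yes cur≡h = hb , _ , subst (TailPath _ (σ best)) cur≡h path
  ... | no cur≢h with r | head cur in hc
  ...   | zero   | _     = contradiction σʳcur≡h cur≢h
  ...   | suc r′ | true  = lastHead-preceding fuel (σ cur) cur hc {0} (refl , λ _ ())
                             r′ (s≤s⁻¹ r≤1+fuel) (trans (pow-sucʳ σ r′ cur) σʳcur≡h)
  ...   | suc r′ | false = lastHead-preceding fuel (σ cur) best hb (tailPath-snoc path hc)
                             r′ (s≤s⁻¹ r≤1+fuel) (trans (pow-sucʳ σ r′ cur) σʳcur≡h)

  precedingHead-spec : ∀ {h} → head h ≡ true → PrecedingHead h (precedingHead h)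
  precedingHead-spec {h} hh with Orbits.period σ-inj h
  ... | p , 1+p≤n , σ¹⁺ᵖh≡h =
    lastHead-preceding n (σ h) h hh {0} (refl , λ _ ())
      p (≤-trans (n≤1+n p) 1+p≤n) (trans (pow-sucʳ σ p h) σ¹⁺ᵖh≡h)

  σ₀-tail : ∀ {x} → head x ≡ false → σ₀ M x ≡ σ x
  σ₀-tail {x} hx = cong (λ b → if b then σ (precedingHead x) else σ x) hx

  σ₀-head : ∀ {x} → head x ≡ true → σ₀ M x ≡ σ (precedingHead x)
  σ₀-head {x} hx = cong (λ b → if b then σ (precedingHead x) else σ x) hx

  precedingHead-injective : ∀ {x y} → head x ≡ true → head y ≡ true → precedingHead x ≡ precedingHead y → x ≡ y
  precedingHead-injective hx hy q≡q′ with precedingHead-spec hx | precedingHead-spec hy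
  ... | _ , _ , path | _ , _ , path′ =
    tailPath-unique path hx (subst (λ q → TailPath _ (σ q) _) (sym q≡q′) path′) hy

  σ₀-injective : Injective _≡_ _≡_ (σ₀ M)
  -- Abstracting `head x` also evaluates the `if` of σ₀ inside `eq`.
  σ₀-injective {x} {y} eq with head x in hx | head y in hy
  ... | false | false = σ-inj eq
  ... | true  | false = contradiction (σ-inj eq) (head≢tail (proj₁ (precedingHead-spec hx)) hy)
  ... | false | true  = contradiction (σ-inj (sym eq)) (head≢tail (proj₁ (precedingHead-spec hy)) hx)
  ... | true  | true  = precedingHead-injective hx hy (σ-inj eq)

  count-tails : count (not ∘ head) ≡ count (λ x → head x ∧ not (does (x ≟ root)))
  count-tails = count-bijection _ _ α α tail⇒nonroot nonroot⇒tail (λ _ → α-invol _) (λ _ → α-invol _)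
    where
    tail⇒nonroot : ∀ {x} → not (head x) ≡ true → head (α x) ∧ not (does (α x ≟ root)) ≡ true
    tail⇒nonroot {x} tx with Bool.not-injective tx
    ... | hx rewrite α-tail hx | dec-false (α x ≟ root) (α-≢root (tail⇒≢root hx)) = refl
    nonroot⇒tail : ∀ {y} → head y ∧ not (does (y ≟ root)) ≡ true → not (head (α y)) ≡ true
    nonroot⇒tail {y} ny with head y in hy | y ≟ root
    ... | true | no y≢root rewrite α-head hy y≢root = refl

  heads-count : 2 * count head ≡ n + 1
  heads-count = arithmetic (count-remove head head-root) count-tails (count-complement head)
    where
    arithmetic : ∀ {H T Q} → H ≡ Q + 1 → T ≡ Q → H + T ≡ n → 2 * H ≡ n + 1
    arithmetic {Q = Q} refl refl refl = solve 1 (λ Q → con 2 :* (Q :+ con 1) := Q :+ con 1 :+ Q :+ con 1) refl Q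
      where open +-*-Solver

  σ₀-pow-tails : ∀ e x → (∀ i → i < e → head (pow σ i x) ≡ false) → pow (σ₀ M) e x ≡ pow σ e x
  σ₀-pow-tails zero    x _     = refl
  σ₀-pow-tails (suc e) x tails =
    trans (cong (σ₀ M) (σ₀-pow-tails e x (λ i i<e → tails i (m≤n⇒m≤1+n i<e)))) (σ₀-tail (tails e (n<1+n e)))

  σ₀-tailPath : ∀ {e x y} → TailPath e x y → pow (σ₀ M) e x ≡ y
  σ₀-tailPath {e} {x} (path , tails) = trans (σ₀-pow-tails e x tails) path

  σ₀-orbit-head : ∀ {h h′} → head h ≡ true → head h′ ≡ true → SameOrbit (σ₀ M) h h′ → h′ ≡ h
  σ₀-orbit-head {h} hh hh′ (k , refl) with precedingHead-spec hh
  ... | _ , d , path , tails = trans (pow-mod (σ₀ M) period k) (only-h (k % suc d) (m%n<n k (suc d))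
                                      (trans (cong head (sym (pow-mod (σ₀ M) period k))) hh′))
    where
    q = precedingHead h
    along : ∀ r → r ≤ d → pow (σ₀ M) (suc r) h ≡ pow σ r (σ q)
    along r r≤d = begin
      pow (σ₀ M) (suc r) h      ≡⟨ pow-sucʳ (σ₀ M) r h ⟨
      pow (σ₀ M) r (σ₀ M h)     ≡⟨ cong (pow (σ₀ M) r) (σ₀-head hh) ⟩
      pow (σ₀ M) r (σ q)        ≡⟨ σ₀-pow-tails r (σ q) (λ i i<r → tails i (<-≤-trans i<r r≤d)) ⟩
      pow σ r (σ q)             ∎
      where open ≡-Reasoning
    period : pow (σ₀ M) (suc d) h ≡ h
    period = trans (along d ≤-refl) path
    only-h : ∀ r → r < suc d → head (pow (σ₀ M) r h) ≡ true → pow (σ₀ M) r h ≡ h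
    only-h zero     _     _  = refl
    only-h (suc r) 1+r<1+d hr = contradiction (along r (<⇒≤ r<d)) (head≢tail hr (tails r r<d))
      where r<d = s≤s⁻¹ 1+r<1+d

  module FirstHead (has-head : ∀ x → Σ ℕ λ k → head (pow σ k x) ≡ true) where

    private
      first : ∀ x → Σ ℕ λ k → head (pow σ k x) ≡ true × (∀ {i} → i < k → ¬ head (pow σ i x) ≡ true)
      first x = minimal-witness (λ k → head (pow σ k x) Bool.≟ true) (proj₁ (has-head x)) (proj₂ (has-head x))

    firstHeadDist : Fin n → ℕ
    firstHeadDist x = proj₁ (first x)

    firstHead : Fin n → Fin n
    firstHead x = pow σ (firstHeadDist x) x

    firstHead-vertex : ∀ x → SameVertex raw x (firstHead x)
    firstHead-vertex x = firstHeadDist x , refl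

    firstHead-head : ∀ x → head (firstHead x) ≡ true
    firstHead-head x = proj₁ (proj₂ (first x))

    firstHead-path : ∀ x → TailPath (firstHeadDist x) x (firstHead x)
    firstHead-path x = refl , λ i i<k → ¬-not (proj₂ (proj₂ (first x)) i<k)

    tailPath-firstHead : ∀ {e x y} → TailPath e x y → head y ≡ true → firstHead x ≡ y
    tailPath-firstHead {x = x} path hy = tailPath-unique (firstHead-path x) (firstHead-head x) path hy

    firstHead-of-head : ∀ {x} → head x ≡ true → firstHead x ≡ x
    firstHead-of-head hx = tailPath-firstHead {0} (refl , λ _ ()) hx

    σ₀-firstHead : ∀ x → SameOrbit (σ₀ M) x (firstHead x)
    σ₀-firstHead x = firstHeadDist x , σ₀-tailPath (firstHead-path x)

    numVertices-φ₀ : numVertices (φ₀ M) ≡ count head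
    numVertices-φ₀ = numCycles-transversal σ₀-injective head firstHead firstHead-head σ₀-firstHead
      λ hx hy x~y → sym (σ₀-orbit-head hx hy x~y)

    euler-φ₀ : numFaces (φ₀ M) ≡ 1 → 2 * (numVertices (φ₀ M) + numFaces (φ₀ M)) ≡ n + 3
    euler-φ₀ one-face rewrite numVertices-φ₀ | one-face =
      trans (*-distribˡ-+ 2 (count head) 1) (trans (cong (_+ 2) heads-count) (+-assoc n 1 2))

    parent : Fin n → Fin n
    parent x = firstHead (α x)

    parent-head : ∀ x → head (parent x) ≡ true
    parent-head x = firstHead-head (α x)

    pow-parent-head : ∀ {h} → head h ≡ true → ∀ l → head (pow parent l h) ≡ true
    pow-parent-head hh zero    = hh
    pow-parent-head hh (suc l) = parent-head _

    pow-parent-root : ∀ l → pow parent l root ≡ root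
    pow-parent-root zero    = refl
    pow-parent-root (suc l) =
      trans (cong parent (pow-parent-root l)) (trans (cong firstHead α-root) (firstHead-of-head head-root))

    beyond-firstHead : ∀ {z y} r → pow σ r z ≡ y → head y ≡ true → y ≢ firstHead z →
                       Σ ℕ λ t → suc t + firstHeadDist z ≡ r × pow σ (suc t) (firstHead z) ≡ y
    beyond-firstHead {z} {y} r σʳz≡y hy y≢gz = t , 1+t+k≡r , (begin
      pow σ (suc t) (pow σ k z) ≡⟨ pow-+ σ (suc t) k z ⟨
      pow σ (suc t + k) z       ≡⟨ cong (λ i → pow σ i z) 1+t+k≡r ⟩
      pow σ r z                 ≡⟨ σʳz≡y ⟩
      y                         ∎)
      where
      open ≡-Reasoning
      k = firstHeadDist z
      k<r : k < r
      k<r = ≤∧≢⇒< (≮⇒≥ λ r<k → head≢tail hy (proj₂ (firstHead-path z) r r<k) (sym σʳz≡y))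
                  (λ k≡r → y≢gz (trans (sym σʳz≡y) (cong (λ i → pow σ i z) (sym k≡r))))
      t = r ∸ suc k
      1+t+k≡r : suc t + k ≡ r
      1+t+k≡r = trans (sym (+-suc t k)) (m∸n+n≡m k<r)

    between-firstHead : ∀ {b y} → head y ≡ true → SameVertex raw b y → y ≢ firstHead b →
                        Between M (firstHead b) b y
    between-firstHead {b} {y} hy (c₀ , σᶜ⁰b≡y) y≢gb with minimal-witness (λ c → pow σ c b ≟ y) c₀ σᶜ⁰b≡y
    ... | c , σᶜb≡y , c-minimal with beyond-firstHead c σᶜb≡y hy y≢gb
    ...   | t , 1+t+k≡c , σgb≡y = t , σgb≡y , avoids-b
      where
      avoids-b : ∀ m → m ≤ t → pow σ (suc m) (firstHead b) ≢ b
      avoids-b m m≤t σgb≡b = c-minimal (≤-<-trans (m∸n≤m t m) (m+n≤o⇒m≤o (suc t) (≤-reflexive 1+t+k≡c)))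
        (trans (cong (pow σ (t ∸ m)) (sym σgb≡b)) (trans (pow-∸-suc σ m≤t (firstHead b)) σgb≡y))

    between-split : ∀ {a b z y} → Between M a b y → head y ≡ true → y ≢ firstHead z →
                    Between M a z y ⊎ Between M (firstHead z) b y
    between-split {a} {b} {z} {y} (j , σa≡y , avoids-b) hy y≢gz
      with anyUpTo? (λ m → pow σ (suc m) a ≟ z) (suc j)
    ... | no avoids-z = inj₁ (j , σa≡y , λ m m≤j σa≡z → avoids-z (m , s≤s m≤j , σa≡z))
    ... | yes (m , 1+m≤1+j , σa≡z) with beyond-firstHead (j ∸ m) σz≡y hy y≢gz
      where
      m≤j = s≤s⁻¹ 1+m≤1+j
      σz≡y : pow σ (j ∸ m) z ≡ y
      σz≡y = trans (cong (pow σ (j ∸ m)) (sym σa≡z)) (trans (pow-∸-suc σ m≤j a) σa≡y)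
    ... | t , 1+t+k≡j∸m , σgz≡y =
      inj₂ (t , σgz≡y , λ m′ m′≤t σgz≡b → avoids-b _ (index≤j m′≤t) (trans (index m′) σgz≡b))
      where
      k = firstHeadDist z
      m≤j = s≤s⁻¹ 1+m≤1+j
      index : ∀ m′ → pow σ (suc (m′ + k + suc m)) a ≡ pow σ (suc m′) (firstHead z)
      index m′ = trans (pow-+ σ (suc m′ + k) (suc m) a)
                       (trans (cong (pow σ (suc m′ + k)) σa≡z) (pow-+ σ (suc m′) k z))
      index≤j : ∀ {m′} → m′ ≤ t → m′ + k + suc m ≤ j
      index≤j {m′} m′≤t = begin
        m′ + k + suc m     ≤⟨ +-monoˡ-≤ (suc m) (+-monoˡ-≤ k m′≤t) ⟩
        t + k + suc m      ≡⟨ trans (+-suc (t + k) m) (+-comm (suc t + k) m) ⟩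
        m + (suc t + k)    ≡⟨ cong (m +_) 1+t+k≡j∸m ⟩
        m + (j ∸ m)        ≡⟨ m+[n∸m]≡n m≤j ⟩
        j                  ∎
        where open ≤-Reasoning

    module Shortcut (B : Fin n → Set) (B-tail : ∀ {b} → B b → head b ≡ false) where

      RightOfCycleIn : Fin n → Set
      RightOfCycleIn y = Σ (DirCycle M) λ C → (∀ i → B (DirCycle.ts C i)) × RightOf M C y

      -- At the base vertex v a step must enter through the first head, so that
      -- between-split applies when the walk comes back to v.
      Link : Fin n → Fin n → Fin n → Set
      Link v x z = SameVertex raw (α x) z × (SameVertex raw z v → α x ≡ firstHead z)

      tight-link : ∀ {v x z} → α x ≡ firstHead z → Link v x z
      tight-link {z = z} αx≡gz =
        subst (λ u → SameVertex raw u z) (sym αx≡gz) (vertex-sym (firstHead-vertex z)) , λ _ → αx≡gz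

      record ClosedWalk (v y b₀ : Fin n) (rest : List (Fin n)) : Set where
        field
          at-v   : SameVertex raw b₀ v
          in-B   : All B (b₀ ∷ rest)
          linked : Chain (Link v) b₀ rest
          closed : SameVertex raw (α (lastFrom b₀ rest)) b₀
          sector : Between M (α (lastFrom b₀ rest)) b₀ y

      ShorterWalk : Fin n → Fin n → ℕ → Set
      ShorterWalk v y m = Σ (Fin n) λ b → Σ (List (Fin n)) λ rest → length rest < m × ClosedWalk v y b rest

      simple-walk-cycle : ∀ {v y b₀ rest} → ClosedWalk v y b₀ rest →
                          AllPairs (λ a b → ¬ SameVertex raw a b) (b₀ ∷ rest) → RightOfCycleIn y
      simple-walk-cycle {v} {y} {b₀} {rest} W distinct =
        C , (λ i → All.lookup in-B (∈-lookup i)) , rt-seed zero sector′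
        where
        open ClosedWalk W
        last≡ = sym (lookup-lastFrom b₀ rest)
        C : DirCycle M
        C = record
          { k      = length rest
          ; ts     = lookup (b₀ ∷ rest)
          ; tails  = λ i → B-tail (All.lookup in-B (∈-lookup i))
          ; linked = λ i → proj₁ (chain-lookup b₀ rest linked i)
          ; closed = subst (λ u → SameVertex raw (α u) b₀) last≡ closed
          ; simple = allPairs-lookup-injective vertex-sym distinct
          }
        sector′ : Between M (DirCycle.inHead C zero) b₀ y
        sector′ = subst (λ u → Between M (α u) b₀ y) last≡ sector

      walk-revisit : ∀ {v y b₀} xs z ys → head y ≡ true → (∀ {b} → B b → α b ≢ y) →
                     ClosedWalk v y b₀ (xs ++ z ∷ ys) → SameVertex raw b₀ z →
                     ShorterWalk v y (length (xs ++ z ∷ ys))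
      walk-revisit {v} {y} {b₀} xs z ys hy avoid W b₀~z with chain-split b₀ xs z ys (ClosedWalk.linked W)
      ... | before , link , after =
        [ (λ sector-z  → z  , ys , length-<-++ʳ xs z ys , from-z sector-z)
        , (λ sector-b₀ → b₀ , xs , length-<-++ˡ xs z ys , from-b₀ sector-b₀)
        ]′ (between-split sector hy y≢gz)
        where
        open ClosedWalk W
        enters-at-firstHead : α (lastFrom b₀ xs) ≡ firstHead z
        enters-at-firstHead = proj₂ link (vertex-trans (vertex-sym b₀~z) at-v)
        y≢gz : y ≢ firstHead z
        y≢gz y≡gz = avoid (lastFrom-All b₀ xs (++⁻ˡ (b₀ ∷ xs) in-B)) (trans enters-at-firstHead (sym y≡gz))
        last≡ : lastFrom b₀ (xs ++ z ∷ ys) ≡ lastFrom z ys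
        last≡ = lastFrom-++ b₀ xs z ys
        from-z : Between M (α (lastFrom b₀ (xs ++ z ∷ ys))) z y → ClosedWalk v y z ys
        from-z sector-z = record
          { at-v   = vertex-trans (vertex-sym b₀~z) at-v
          ; in-B   = ++⁻ʳ (b₀ ∷ xs) in-B
          ; linked = after
          ; closed = subst (λ u → SameVertex raw (α u) z) last≡ (vertex-trans closed b₀~z)
          ; sector = subst (λ u → Between M (α u) z y) last≡ sector-z
          }
        from-b₀ : Between M (firstHead z) b₀ y → ClosedWalk v y b₀ xs
        from-b₀ sector-b₀ = record
          { at-v   = at-v
          ; in-B   = ++⁻ˡ (b₀ ∷ xs) in-B
          ; linked = before
          ; closed = vertex-trans (proj₁ link) (vertex-sym b₀~z)
          ; sector = subst (λ u → Between M u b₀ y) (sym enters-at-firstHead) sector-b₀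
          }

      walk-cut : ∀ {v y b₀} as u bs w cs → ClosedWalk v y b₀ (as ++ u ∷ bs ++ w ∷ cs) →
                 All (λ x → ¬ SameVertex raw b₀ x) (as ++ u ∷ bs ++ w ∷ cs) → SameVertex raw u w →
                 ShorterWalk v y (length (as ++ u ∷ bs ++ w ∷ cs))
      walk-cut {v} {y} {b₀} as u bs w cs W away u~w with chain-split b₀ as u (bs ++ w ∷ cs) (ClosedWalk.linked W)
      ... | before , link-u , from-u with chain-split u bs w cs from-u
      ...   | _ , _ , after = b₀ , as ++ w ∷ cs , length-<-cut as u bs w cs , record
        { at-v   = at-v
        ; in-B   = ++⁺ (++⁻ˡ (b₀ ∷ as) in-B) (++⁻ʳ bs (All.tail (++⁻ʳ (b₀ ∷ as) in-B)))
        ; linked = chain-join b₀ as w cs before link-w after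
        ; closed = subst (λ x → SameVertex raw (α x) b₀) (sym last≡) closed
        ; sector = subst (λ x → Between M (α x) b₀ y) (sym last≡) sector
        }
        where
        open ClosedWalk W
        b₀≁w : ¬ SameVertex raw b₀ w
        b₀≁w = All.head (++⁻ʳ bs (All.tail (++⁻ʳ as away)))
        link-w : Link v (lastFrom b₀ as) w
        link-w = vertex-trans (proj₁ link-u) u~w , λ w~v → contradiction (vertex-trans at-v (vertex-sym w~v)) b₀≁w
        last≡ : lastFrom b₀ (as ++ w ∷ cs) ≡ lastFrom b₀ (as ++ u ∷ bs ++ w ∷ cs)
        last≡ = trans (lastFrom-++ b₀ as w cs)
                      (sym (trans (lastFrom-++ b₀ as u (bs ++ w ∷ cs)) (lastFrom-++ u bs w cs)))

      shortcut : ∀ {v y} → head y ≡ true → (∀ {b} → B b → α b ≢ y) →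
                 ∀ {b₀} rest → Acc _<_ (length rest) → ClosedWalk v y b₀ rest → RightOfCycleIn y
      shortcut hy avoid {b₀} rest (acc smaller) W with any? (vertex? b₀) rest
      ... | yes revisit with split-at-any revisit
      ...   | xs , z , ys , refl , b₀~z with walk-revisit xs z ys hy avoid W b₀~z
      ...     | _ , rest′ , shorter , W′ = shortcut hy avoid rest′ (smaller shorter) W′
      shortcut hy avoid {b₀} rest (acc smaller) W | no none with repetition-or-allPairs vertex? rest
      ... | inj₁ (as , u , bs , w , cs , refl , u~w) with walk-cut as u bs w cs W (¬Any⇒All¬ rest none) u~w
      ...   | _ , rest′ , shorter , W′ = shortcut hy avoid rest′ (smaller shorter) W′
      shortcut hy avoid {b₀} rest (acc smaller) W | no none | inj₂ distinct =
        simple-walk-cycle W (¬Any⇒All¬ rest none ∷ distinct)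

    module ParentChainsReachRoot
      (root-within : ∀ {c} → head c ≡ true → Σ ℕ λ N → N ≤ n × pow parent N c ≡ root) where

      Reach₀ : Fin n → Set
      Reach₀ = Reach (φ₀ M) head

      reach₀-pow : ∀ m {y} → Reach₀ y → Reach₀ (pow (σ₀ M) m y)
      reach₀-pow zero    r = r
      reach₀-pow (suc m) r = r-σ (reach₀-pow m r)

      reach₀-firstHead : ∀ {x} → Reach₀ (firstHead x) → Reach₀ x
      reach₀-firstHead {x} r with Orbits.orbit-sym σ₀-injective (σ₀-firstHead x)
      ... | m , σ₀ᵐgx≡x = subst Reach₀ σ₀ᵐgx≡x (reach₀-pow m r)

      reach₀-chain : ∀ N {h} → head h ≡ true → pow parent N h ≡ root → Reach₀ h
      reach₀-chain zero    _  refl = r-root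
      reach₀-chain (suc N) {h} hh parᴺ⁺¹h≡root with h ≟ root
      ... | yes refl    = r-root
      ... | no h≢root = subst Reach₀ (α-invol h)
        (r-edge (reach₀-firstHead (reach₀-chain N (parent-head h) (trans (pow-sucʳ parent N h) parᴺ⁺¹h≡root)))
                (α-head hh h≢root))

      reach₀ : ∀ x → Reach₀ x
      reach₀ x with root-within (firstHead-head x)
      ... | N , _ , reach = reach₀-firstHead (reach₀-chain N (firstHead-head x) reach)

      face : Fin n → Fin n
      face x = σ₀ M (α x)

      face-injective : Injective _≡_ _≡_ face
      face-injective = α-injective ∘ σ₀-injective

      open Orbits face-injective using (orbit-refl; orbit-trans)

      ReturnsTo : Fin n → Set
      ReturnsTo h = ∀ {e x} → TailPath e x h → SameOrbit face x h

      face-around-child : ∀ {t} → head t ≡ false → ReturnsTo (α t) → SameOrbit face t (σ t)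
      face-around-child {t} ht returns with precedingHead-spec (α-tail ht)
      ... | _ , _ , path = orbit-trans (1 , σ₀-head (α-tail ht)) (orbit-trans (returns path) (1 , leave))
        where
        leave : face (α t) ≡ σ t
        leave = trans (cong (σ₀ M) (α-invol t)) (σ₀-tail ht)

      HeightBelow : ℕ → Fin n → Set
      HeightBelow N h = ∀ {c} → head c ≡ true → (∀ i → i < N → pow parent i c ≢ root) → pow parent N c ≢ h

      heightBelow-child : ∀ {N c} → HeightBelow (suc N) (parent c) → c ≢ root → HeightBelow N c
      heightBelow-child {N} below c≢root {c′} hc′ avoids parᴺc′≡c = below hc′ avoids′ (cong parent parᴺc′≡c)
        where
        avoids′ : ∀ i → i < suc N → pow parent i c′ ≢ root
        avoids′ i i<1+N with m≤n⇒m<n∨m≡n (s≤s⁻¹ i<1+N)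
        ... | inj₁ i<N  = avoids i i<N
        ... | inj₂ refl = λ parⁱc′≡root → c≢root (trans (sym parᴺc′≡c) parⁱc′≡root)

      returnsTo-below : ∀ N {h} → head h ≡ true → HeightBelow N h → ReturnsTo h
      returnsTo-below zero    hh below _ = contradiction refl (below hh λ _ ())
      returnsTo-below (suc N) hh below {zero} (refl , _) = orbit-refl
      returnsTo-below (suc N) {h} hh below {suc e} {x} path =
        orbit-trans (face-around-child hx (returnsTo-below N (α-tail hx) (heightBelow-child below′ αx≢root)))
                    (returnsTo-below (suc N) hh below (tailPath-uncons path))
        where
        hx : head x ≡ false
        hx = proj₂ path 0 z<s
        below′ : HeightBelow (suc N) (parent (α x))
        below′ = subst (HeightBelow (suc N)) (sym (trans (cong firstHead (α-invol x)) (tailPath-firstHead path hh))) below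
        αx≢root : α x ≢ root
        αx≢root = α-≢root (tail⇒≢root hx)

      returnsTo : ∀ {h} → head h ≡ true → ReturnsTo h
      returnsTo hh = returnsTo-below (suc n) hh λ hc avoids _ →
        let N , N≤n , parᴺc≡root = root-within hc in avoids N (s≤s N≤n) parᴺc≡root

      face-to-parent : ∀ {h} → head h ≡ true → h ≢ root → SameOrbit face h (parent h)
      face-to-parent {h} hh h≢root with tailPath-from-tail (α-head hh h≢root) (firstHead-path (α h)) (parent-head h)
      ... | _ , path = orbit-trans (1 , σ₀-tail (α-head hh h≢root)) (returnsTo (parent-head h) path)

      face-to-root : ∀ N {h} → head h ≡ true → pow parent N h ≡ root → SameOrbit face h root
      face-to-root zero    _  refl = orbit-refl
      face-to-root (suc N) {h} hh parᴺ⁺¹h≡root with h ≟ root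
      ... | yes refl    = orbit-refl
      ... | no h≢root = orbit-trans (face-to-parent hh h≢root)
                          (face-to-root N (parent-head h) (trans (pow-sucʳ parent N h) parᴺ⁺¹h≡root))

      numFaces-φ₀ : numFaces (φ₀ M) ≡ 1
      numFaces-φ₀ = numCycles-transitive face-injective root λ x →
        let N , _ , reach = root-within (firstHead-head x)
        in orbit-trans (returnsTo (firstHead-head x) (firstHead-path x)) (face-to-root N (firstHead-head x) reach)

reach⇒conn : ∀ {n} {R : RawMap n} {head} {x} → Reach R head x → Conn R x
reach⇒conn r-root       = c-root
reach⇒conn (r-σ r)      = c-σ (reach⇒conn r)
reach⇒conn (r-edge r _) = c-α (reach⇒conn r)

module TreeOrientedMap {n : ℕ} (M : OrientedMap n) (tree-oriented : TreeOriented M) where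
  open OrientedMap M
  open IsMap isMap
  open Explosion M

  no-positive-cycle : ¬ PositiveCycle M
  no-positive-cycle = proj₁ tree-oriented

  reach : ∀ x → Reach raw head x
  reach = proj₂ tree-oriented

  has-head : ∀ x → Σ ℕ λ k → head (pow σ k x) ≡ true
  has-head x = reached-has-head (reach x)
    where
    reached-has-head : ∀ {x} → Reach raw head x → Σ ℕ λ k → head (pow σ k x) ≡ true
    reached-has-head r-root           = 0 , head-root
    reached-has-head (r-edge _ ht)    = 0 , α-tail ht
    reached-has-head (r-σ {x} r) with reached-has-head r | vertex-sym {x} (1 , refl)
    ... | k , hk | m , σᵐσx≡x = k + m , trans (cong head (trans (pow-+ σ k m (σ x)) (cong (pow σ k) σᵐσx≡x))) hk

  open FirstHead has-head public

  module ParentCycle {h} (hh : head h ≡ true) (h≢root : h ≢ root) (j : ℕ) (cycle : pow parent (suc j) h ≡ h)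
    where

    rotate : ∀ m → pow parent (suc j) (pow parent m h) ≡ pow parent m h
    rotate m = begin
      pow parent (suc j) (pow parent m h) ≡⟨ pow-+ parent (suc j) m h ⟨
      pow parent (suc j + m) h            ≡⟨ cong (λ k → pow parent k h) (+-comm (suc j) m) ⟩
      pow parent (m + suc j) h            ≡⟨ pow-+ parent m (suc j) h ⟩
      pow parent m (pow parent (suc j) h) ≡⟨ cong (pow parent m) cycle ⟩
      pow parent m h                      ∎
      where open ≡-Reasoning

    on-cycle-≢root : ∀ l → pow parent l h ≢ root
    on-cycle-≢root l parˡh≡root = h≢root (begin
      h                                   ≡⟨ pow-periodic parent cycle l ⟨
      pow parent (l * suc j) h            ≡⟨ cong (λ k → pow parent k h) (trans (*-suc l j) (+-comm l (l * j))) ⟩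
      pow parent (l * j + l) h            ≡⟨ pow-+ parent (l * j) l h ⟩
      pow parent (l * j) (pow parent l h) ≡⟨ cong (pow parent (l * j)) parˡh≡root ⟩
      pow parent (l * j) root             ≡⟨ pow-parent-root (l * j) ⟩
      root                                ∎)
      where open ≡-Reasoning

    CycleTail : Fin n → Set
    CycleTail b = Σ ℕ λ l → b ≡ α (pow parent l h)

    cycleTail-tail : ∀ {b} → CycleTail b → head b ≡ false
    cycleTail-tail (l , refl) = α-head (pow-parent-head hh l) (on-cycle-≢root l)

    open Shortcut CycleTail cycleTail-tail

    descent : ℕ → Fin n → List (Fin n)
    descent zero    c = []
    descent (suc i) c = α (pow parent i c) ∷ descent i c

    descent-chain : ∀ {v} i c → Chain (Link v) (α (pow parent i c)) (descent i c)
    descent-chain zero    c = tt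
    descent-chain (suc i) c = tight-link (α-invol _) , descent-chain i c

    descent-last : ∀ i c → lastFrom (α (pow parent i c)) (descent i c) ≡ α c
    descent-last zero    c = refl
    descent-last (suc i) c = descent-last i c

    descent-cycleTails : ∀ i l → All CycleTail (α (pow parent i (pow parent l h)) ∷ descent i (pow parent l h))
    descent-cycleTails zero    l = (l , refl) ∷ []
    descent-cycleTails (suc i) l = (suc i + l , cong α (sym (pow-+ parent (suc i) l h))) ∷ descent-cycleTails i l

    walk-around : ∀ {y b} → head y ≡ true → (∀ {b} → CycleTail b → α b ≢ y) → CycleTail b → SameVertex raw y b →
                  RightOfCycleIn y
    walk-around {y} hy avoid (l , refl) y~b = shortcut hy avoid (descent j q) (<-wellFounded _) W
      where
      open ≡-Reasoning
      q = pow parent (suc l) h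
      b₀ = α (pow parent j q)
      firstHead-b₀ : firstHead b₀ ≡ q
      firstHead-b₀ = rotate (suc l)
      b₀≡b : pow parent j q ≡ pow parent l h
      b₀≡b = begin
        pow parent j (pow parent (suc l) h) ≡⟨ pow-+ parent j (suc l) h ⟨
        pow parent (j + suc l) h            ≡⟨ cong (λ k → pow parent k h) (+-suc j l) ⟩
        pow parent (suc j + l) h            ≡⟨ pow-+ parent (suc j) l h ⟩
        pow parent (suc j) (pow parent l h) ≡⟨ rotate l ⟩
        pow parent l h                      ∎
      closing : firstHead b₀ ≡ α (lastFrom b₀ (descent j q))
      closing = trans firstHead-b₀ (trans (sym (α-invol q)) (cong α (sym (descent-last j q))))
      b₀~y : SameVertex raw b₀ y
      b₀~y = subst (λ u → SameVertex raw (α u) y) (sym b₀≡b) (vertex-sym y~b)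
      y≢gb₀ : y ≢ firstHead b₀
      y≢gb₀ y≡gb₀ = avoid (suc l , refl) (trans (α-invol q) (sym (trans y≡gb₀ firstHead-b₀)))
      W : ClosedWalk b₀ y b₀ (descent j q)
      W = record
        { at-v   = vertex-refl
        ; in-B   = descent-cycleTails j (suc l)
        ; linked = descent-chain j q
        ; closed = subst (λ u → SameVertex raw u b₀) closing (vertex-sym (firstHead-vertex b₀))
        ; sector = subst (λ u → Between M u b₀ y) closing (between-firstHead hy b₀~y y≢gb₀)
        }

    Away : Fin n → Set
    Away x = ∀ {b} → CycleTail b → ¬ SameVertex raw x b

    away-rightOf-σ⁻ : ∀ {x} (C : DirCycle M) → (∀ i → CycleTail (DirCycle.ts C i)) → Away x →
                      RightOf M C (σ x) → RightOf M C x
    away-rightOf-σ⁻ {x} C on-cycle away right with Orbits.period σ-inj x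
    ... | p , _ , σᵖ⁺¹x≡x = subst (RightOf M C) (trans (pow-sucʳ σ p x) σᵖ⁺¹x≡x) (around p)
      where
      around : ∀ m → RightOf M C (pow σ m (σ x))
      around zero    = right
      around (suc m) = rt-σ (around m) λ i x′~tsᵢ →
        away (on-cycle i) (vertex-trans (suc m , sym (pow-sucʳ σ m x)) x′~tsᵢ)

    invariant : ∀ {x} → Reach raw head x → ¬ RightOfCycleIn x × Away x
    invariant r-root = not-right-root , λ b-on root~b → not-right-root (walk-around head-root avoid-root b-on root~b)
      where
      not-right-root : ¬ RightOfCycleIn root
      not-right-root (C , _ , right) = no-positive-cycle record { cycle = C ; rootRight = right }
      avoid-root : ∀ {b} → CycleTail b → α b ≢ root
      avoid-root (l , refl) = on-cycle-≢root l ∘ trans (sym (α-invol _))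
    invariant (r-σ {x} r) with invariant r
    ... | not-right , away =
        (λ (C , on-cycle , right) → not-right (C , on-cycle , away-rightOf-σ⁻ C on-cycle away right))
      , (λ b-on σx~b → away b-on (vertex-trans (1 , refl) σx~b))
    invariant (r-edge {t} r ht) with invariant r
    ... | not-right , away =
      not-right-αt , λ b-on αt~b → not-right-αt (walk-around (α-tail ht) avoid-αt b-on αt~b)
      where
      not-right-αt : ¬ RightOfCycleIn (α t)
      not-right-αt (C , on-cycle , right) = not-right (C , on-cycle , subst (RightOf M C) (α-invol t) (rt-α right))
      avoid-αt : ∀ {b} → CycleTail b → α b ≢ α t
      avoid-αt b-on αb≡αt = away b-on (subst (SameVertex raw t) (sym (α-injective αb≡αt)) vertex-refl)

    absurd : ⊥
    absurd = proj₂ (invariant (reach (α h))) (0 , refl) vertex-refl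

  root-within : ∀ {c} → head c ≡ true → Σ ℕ λ N → N ≤ n × pow parent N c ≡ root
  root-within {c} hc with anyUpTo? (λ N → pow parent N c ≟ root) (suc n)
  ... | yes (N , N<1+n , reached) = N , s≤s⁻¹ N<1+n , reached
  ... | no unreached with pow-eventually-periodic parent c
  ...   | i , d , i+d+1≤n , periodic = ⊥-elim (ParentCycle.absurd (pow-parent-head hc i) off-root d periodic)
    where
    off-root : pow parent i c ≢ root
    off-root reached = unreached (i , s≤s (≤-trans (m≤m+n i (suc d)) i+d+1≤n) , reached)

  open ParentChainsReachRoot root-within public

lemma5 : ∀ {n} (M : OrientedMap n) → TreeOriented M →
    IsTree (φ₀ M) × (∀ x → Reach (φ₀ M) (OrientedMap.head M) x)
lemma5 M tree-oriented = (φ₀-isMap , numFaces-φ₀) , reach₀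
  where
  open OrientedMap M
  open IsMap isMap
  open Explosion M using (σ₀-injective)
  open TreeOrientedMap M tree-oriented
  φ₀-isMap : IsMap (φ₀ M)
  φ₀-isMap = record
    { σ-inj     = σ₀-injective
    ; α-invol   = α-invol
    ; α-root    = α-root
    ; α-fix     = α-fix
    ; connected = reach⇒conn ∘ reach₀
    ; planar    = euler-φ₀ numFaces-φ₀
    }
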